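{- Let $G$ be the weighted majority graph of an election and run the algorithm $\mathcal{A}$ described in the context. Suppose that before some iteration of the while loop the set $S$ has size $s$, and let $S'$ be the value of $S$ after that iteration. Then for every integer $i$ with $1\le i<s$, \[\Pr[|S'|\le i]\ \ge\ \frac{i+1}{s}.\]
   Context: An election consists of a finite set $M$ of $m$ candidates and a finite set $N$ of voters, each voter having a strict partial order preference on $M$. For candidates $x\neq y$, let $P(x,y)$ be the number of voters who prefer $x$ to $y$. The weighted majority graph $G=G_{M,N,P}$ is the complete directed graph on vertex set $M$ with, for each ordered pair $x\neq y$, a directed edge from $x$ to $y$ of weight $P(x,y)-P(y,x)$. The beatpath strength $B(x,y)$ is the maximum, over all directed paths from $x$ to $y$ in $G$, of the minimum edge weight on the path (for $x\ne y$; $B(x,x)=+\infty$). The Schulze order is the strict partial order $x<y$ iff $B(x,y)<B(y,x)$; $x\,\|\,y$ means neither $x<y$ nor $y<x$. Algorithm $\mathcal{A}$ (input: $G$): (1) Let $S$ be the set of all vertices. (2) While $|S|>1$: (a) choose a uniformly random $p\in S$ (independently of previous choices); (b) partition $S$ into $L=\{x\in S:x<p\}$, $I=\{x\in S:x\,\|\,p\}$, $H=\{x\in S:p<x\}$ (computed via maxmin-weight paths in the whole graph $G$); (c) if $H\neq\emptyset$ set $S=H$, else set $S=\{p\}$. (3) Let $p$ be the unique element of $S$. (4) Partition all candidates into those less than, incomparable to, and greater than $p$, and report $p$ as the unique maximal element iff the incomparable set is $\{p\}$. -}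

module Defs where

open import Data.Nat using (ℕ; zero; suc; _≤_; _<_; _≡ᵇ_; _≤ᵇ_)
open import Data.Integer as ℤ using (ℤ; +_; _-_; _⊔_; _⊓_)
open import Data.Bool using (Bool; true; false; T; _∧_; not; if_then_else_)
open import Data.Fin using (Fin; _≟_)
open import Data.Fin.Subset using (Subset; ⊤; ⁅_⁆; ∣_∣; _∈_)
open import Data.Vec using (tabulate; lookup)
open import Data.List using (List; []; _∷_; _++_; [_]; map; foldr; filter; concatMap; allFin; length)
open import Relation.Nullary using (¬_; does)
open import Relation.Binary.PropositionalEquality using (_≡_)
import Data.List.Relation.Unary.Unique.DecPropositional as UniqueDec

-- A strict partial order on a finite set of candidates Fin m,
-- given as a Boolean relation  pref x y = "x is preferred to y".
record StrictPartialOrder (m : ℕ) : Set where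
  field
    pref    : Fin m → Fin m → Bool
    irrefl  : ∀ x → pref x x ≡ false
    trans   : ∀ x y z → T (pref x y) → T (pref y z) → T (pref x z)

Election : ℕ → ℕ → Set
Election m n = Fin n → StrictPartialOrder m

module _ {m n : ℕ} (E : Election m n) where

  countVoters : (Fin n → Bool) → ℕ
  countVoters f = length (filter (λ v → Data.Bool._≟_ (f v) true) (allFin n))

  P : Fin m → Fin m → ℕ
  P x y = countVoters (λ v → StrictPartialOrder.pref (E v) x y)

  w : Fin m → Fin m → ℤ
  w x y = + P x y - + P y x

  allLists : ℕ → List (List (Fin m))
  allLists zero = [] ∷ []
  allLists (suc k) = [] ∷ concatMap (λ v → map (v ∷_) (allLists k)) (allFin m)

  minWeight : Fin m → List (Fin m) → Fin m → ℤ
  minWeight x [] y = w x y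
  minWeight x (v ∷ vs) y = w x v ⊓ minWeight v vs y

  -- Every simple path
  -- has at most m vertices, so all of them appear in allLists m.
  pathIntermediates : Fin m → Fin m → List (List (Fin m))
  pathIntermediates x y =
    filter (λ vs → UniqueDec.unique? _≟_ (x ∷ vs ++ [ y ])) (allLists m)

  -- B(x,x) = +∞ is handled in _<ˢ_.
  B : Fin m → Fin m → ℤ
  B x y = foldr _⊔_ (w x y) (map (λ vs → minWeight x vs y) (pathIntermediates x y))

  -- Schulze order (Boolean): x < y iff x ≠ y and B(x,y) < B(y,x)
  -- (for x = y both strengths are +∞, so x < x never holds)
  _<ˢ_ : Fin m → Fin m → Bool
  x <ˢ y = not (does (x ≟ y)) ∧ does (B x y ℤ.<? B y x)

  higher : Subset m → Fin m → Subset m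
  higher S p = tabulate (λ x → lookup S x ∧ (p <ˢ x))

  step : Subset m → Fin m → Subset m
  step S p = if ∣ higher S p ∣ ≡ᵇ 0 then ⁅ p ⁆ else higher S p

  data Reachable : Subset m → Set where
    start : Reachable ⊤
    next  : ∀ {S} p → Reachable S → 1 < ∣ S ∣ → p ∈ S → Reachable (step S p)

  goodPivots : Subset m → ℕ → Subset m
  goodPivots S i = tabulate (λ p → lookup S p ∧ (∣ step S p ∣ ≤ᵇ i))

-- Beatpath strength satisfies the weakest-link inequality
-- min (B(x,y), B(y,z)) ≤ B(x,z) for x ≠ z: gluing optimal paths from x to y
-- and from y to z gives a walk all of whose edges weigh at least that minimum,
-- and shortcutting its repeated vertices leaves a simple path. Hence the
-- Schulze relation is a strict partial order.
--
-- In a strict partial order on a finite set S, for every k ≤ |S| at least k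
-- elements have fewer than k elements of S above them: for k = |S| this is
-- irreflexivity, and otherwise one removes a minimal element of S, which lies
-- above no other element. With k = i + 1 every such pivot p leaves |S'| ≤ i,
-- as S' is either the set of elements of S above p or {p}.
module Submission where

open import Data.Bool using (Bool; true; false; T; _∧_)
open import Data.Bool.Properties using (T-∧; T-≡; T?)
open import Data.Fin using (Fin; _≟_)
open import Data.Fin.Induction using (spo-wellFounded)
open import Data.Fin.Properties using (pigeonhole; any?) renaming (<⇒≢ to <⇒≢ᶠ)
open import Data.Fin.Subset using (Subset; ∣_∣; _∈_; _⊆_; _-_; Nonempty; inside; outside)
open import Data.Fin.Subset.Properties
  using (x∈p∧x≢y⇒x∈p-y; x∈p⇒∣p-x∣<∣p∣; p─q⊆p; p─⊥≡p; p⊆q⇒∣p∣≤∣q∣; nonempty?; Empty-unique; ∣⊥∣≡0; ∣⁅x⁆∣≡1)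
  renaming (_∈?_ to _∈ˢ?_)
open import Data.Integer using (ℤ; _⊔_; _<?_) renaming (_≤_ to _≤ℤ_; _<_ to _<ℤ_)
open import Data.Integer.Properties
  using (≤-total; <-asym; <⇒≱; ≰⇒>; ⊔-sel; ⊓-glb; i⊓j≤i; i⊓j≤j; i≤i⊔j; i≤j⊔i)
  renaming (≤-trans to ≤ℤ-trans; ≤-refl to ≤ℤ-refl)
open import Data.List using (List; []; _∷_; _++_; [_]; length; lookup; foldr; map)
open import Data.List.Properties using (++-assoc; ∷-injectiveˡ; length-++-≤ˡ)
open import Data.List.Membership.Propositional using () renaming (_∈_ to _∈ˡ_)
open import Data.List.Membership.Propositional.Properties
  using (∈-∃++; ∈-map⁺; ∈-map⁻; ∈-filter⁺; ∈-concatMap⁺; ∈-allFin; ∈-lookup)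
import Data.List.Membership.DecPropositional as DecMembership
open import Data.List.Relation.Unary.All using ([]; _∷_)
import Data.List.Relation.Unary.All as All
open import Data.List.Relation.Unary.All.Properties using (++⁻ˡ)
open import Data.List.Relation.Unary.AllPairs using ([]; _∷_)
open import Data.List.Relation.Unary.Any using (here; there)
import Data.List.Relation.Unary.Any as Any
open import Data.List.Relation.Unary.Linked using (Linked; []; [-]; _∷_)
open import Data.List.Relation.Unary.Unique.Propositional using (Unique)
import Data.List.Relation.Unary.Unique.Propositional.Properties as Unique
open import Data.Nat using (ℕ; zero; suc; _≤_; _<_; _+_; _∸_; _<ᵇ_; _≤ᵇ_; _≡ᵇ_; s≤s; z<s)
  renaming (_<?_ to _<ℕ?_)
open import Data.Nat.Properties
  using (module ≤-Reasoning; ≤-trans; ≤-reflexive; ≤-<-trans; ≤-pred; ≮⇒≥; n≤1+n; <⇒≢; +-comm;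
         m∸n+n≡m; suc-injective; <ᵇ⇒<; <⇒<ᵇ; ≤⇒≤ᵇ)
open import Data.Product using (∃; _×_; _,_; proj₁)
open import Data.Sum using (_⊎_; inj₁; inj₂)
open import Data.Vec using (_∷_; tabulate; here; there) renaming (lookup to lookupᵛ)
open import Data.Vec.Properties using ([]=⇒lookup; lookup⇒[]=; lookup∘tabulate)
open import Function.Base using (_∘_)
open import Function.Bundles using (_⇔_; mk⇔; Equivalence)
open import Induction.WellFounded using (Acc; acc)
open import Level using (Level; 0ℓ)
open import Relation.Binary.Core using (Rel)
open import Relation.Binary.Definitions using (DecidableEquality; Irreflexive; Transitive)
open import Relation.Binary.PropositionalEquality
  using (_≡_; _≢_; ≢-sym; refl; sym; trans; cong; subst; isEquivalence; resp₂)
open import Relation.Binary.Structures using (IsStrictPartialOrder)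
open import Relation.Nullary using (¬_; yes; no; contradiction; _×-dec_)

open import Defs

private variable
  a ℓ : Level
  A : Set a

Unique-++⁻ˡ : ∀ (xs : List A) {ys} → Unique (xs ++ ys) → Unique xs
Unique-++⁻ˡ []       _           = []
Unique-++⁻ˡ (x ∷ xs) (x∉ ∷ uniq) = ++⁻ˡ xs x∉ ∷ Unique-++⁻ˡ xs uniq

Unique⇒lookup-injective : ∀ (xs : List A) → Unique xs → ∀ {i j} → lookup xs i ≡ lookup xs j → i ≡ j
Unique⇒lookup-injective (x ∷ xs) (x∉ ∷ uniq) {Fin.zero}  {Fin.zero}  _  = refl
Unique⇒lookup-injective (x ∷ xs) (x∉ ∷ uniq) {Fin.zero}  {Fin.suc j} eq = contradiction eq (All.lookup x∉ (∈-lookup j))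
Unique⇒lookup-injective (x ∷ xs) (x∉ ∷ uniq) {Fin.suc i} {Fin.zero}  eq = contradiction (sym eq) (All.lookup x∉ (∈-lookup i))
Unique⇒lookup-injective (x ∷ xs) (x∉ ∷ uniq) {Fin.suc i} {Fin.suc j} eq = cong Fin.suc (Unique⇒lookup-injective xs uniq eq)

length-Unique≤ : ∀ {m} {xs : List (Fin m)} → Unique xs → length xs ≤ m
length-Unique≤ {m} {xs} uniq with m <ℕ? length xs
... | no  m≮ = ≮⇒≥ m≮
... | yes m< with i , j , i<j , eq ← pigeonhole m< (lookup xs) =
  contradiction (Unique⇒lookup-injective xs uniq eq) (<⇒≢ᶠ i<j)

module _ {R : Rel A ℓ} where

  Linked-++⁻ˡ : ∀ xs {ys} → Linked R (xs ++ ys) → Linked R xs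
  Linked-++⁻ˡ []           _         = []
  Linked-++⁻ˡ (x ∷ [])     _         = [-]
  Linked-++⁻ˡ (x ∷ y ∷ xs) (r ∷ lnk) = r ∷ Linked-++⁻ˡ (y ∷ xs) lnk

  Linked-∷ʳ : ∀ xs {y z} → Linked R (xs ++ [ y ]) → R y z → Linked R ((xs ++ [ y ]) ++ [ z ])
  Linked-∷ʳ []           _          r = r ∷ [-]
  Linked-∷ʳ (x ∷ [])     (r′ ∷ [-]) r = r′ ∷ r ∷ [-]
  Linked-∷ʳ (x ∷ y ∷ xs) (r′ ∷ lnk) r = r′ ∷ Linked-∷ʳ (y ∷ xs) lnk r

  Linked-join : ∀ us {x y z vs} → Linked R (x ∷ us ++ [ y ]) → Linked R (y ∷ vs ++ [ z ]) →
                Linked R (x ∷ (us ++ y ∷ vs) ++ [ z ])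
  Linked-join []       (r ∷ [-])  lnk₂ = r ∷ lnk₂
  Linked-join (u ∷ us) (r ∷ lnk₁) lnk₂ = r ∷ Linked-join us lnk₁ lnk₂

module SimplePaths {A : Set a} (_≟ᴬ_ : DecidableEquality A) (R : Rel A ℓ) where
  open DecMembership _≟ᴬ_ using () renaming (_∈?_ to _∈ˡ?_)

  SimplePath : A → A → Set _
  SimplePath x y = ∃ λ vs → Unique (x ∷ vs ++ [ y ]) × Linked R (x ∷ vs ++ [ y ])

  SimplePath⁼ : A → A → Set _
  SimplePath⁼ x y = x ≡ y ⊎ SimplePath x y

  -- If z already occurs on the path, the path is cut back to that occurrence.
  snoc : ∀ {x y z} → SimplePath⁼ x y → R y z → SimplePath⁼ x z
  snoc {x} {z = z} (inj₁ refl) r with z ≟ᴬ x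
  ... | yes z≡x = inj₁ (sym z≡x)
  ... | no  z≢x = inj₂ ([] , ((z≢x ∘ sym) ∷ []) ∷ [] ∷ [] , r ∷ [-])
  snoc {x} {y} {z} (inj₂ (vs , uniq , lnk)) r with z ∈ˡ? (x ∷ vs ++ [ y ])
  ... | no z∉ =
    inj₂ (vs ++ [ y ] , Unique.++⁺ uniq ([] ∷ []) (λ { (z∈ , here refl) → z∉ z∈ }) , Linked-∷ʳ (x ∷ vs) lnk r)
  ... | yes z∈ with ∈-∃++ z∈
  ...   | []       , _  , eq = inj₁ (∷-injectiveˡ eq)
  ...   | (_ ∷ us) , ws , eq with refl ← ∷-injectiveˡ eq =
    inj₂ (us , Unique-++⁻ˡ (x ∷ us ++ [ z ]) (subst Unique eq′ uniq)
             , Linked-++⁻ˡ (x ∷ us ++ [ z ]) (subst (Linked R) eq′ lnk))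
    where
    eq′ : x ∷ vs ++ [ y ] ≡ ((x ∷ us) ++ [ z ]) ++ ws
    eq′ = trans eq (sym (++-assoc (x ∷ us) [ z ] ws))

  shortcut : ∀ {x y} vs → Linked R (x ∷ vs ++ [ y ]) → SimplePath⁼ x y
  shortcut vs = walk vs (inj₁ refl)
    where
    walk : ∀ {x y z} vs → SimplePath⁼ x y → Linked R (y ∷ vs ++ [ z ]) → SimplePath⁼ x z
    walk []       p (r ∷ [-]) = snoc p r
    walk (v ∷ vs) p (r ∷ lnk) = walk vs (snoc p r) lnk

foldr-⊔-∈ : ∀ s (xs : List ℤ) → foldr _⊔_ s xs ∈ˡ s ∷ xs
foldr-⊔-∈ s []       = here refl
foldr-⊔-∈ s (x ∷ xs) with ⊔-sel x (foldr _⊔_ s xs) | foldr-⊔-∈ s xs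
... | inj₁ eq | _          = there (here eq)
... | inj₂ eq | here  r≡s  = here (trans eq r≡s)
... | inj₂ eq | there r∈xs = there (there (subst (_∈ˡ xs) (sym eq) r∈xs))

∈⇒≤foldr-⊔ : ∀ s {x} {xs : List ℤ} → x ∈ˡ xs → x ≤ℤ foldr _⊔_ s xs
∈⇒≤foldr-⊔ s               (here refl) = i≤i⊔j _ _
∈⇒≤foldr-⊔ s {xs = y ∷ _} (there x∈)  = ≤ℤ-trans (∈⇒≤foldr-⊔ s x∈) (i≤j⊔i y _)

module Beatpath {m n} (E : Election m n) where

  AtLeast : ℤ → Rel (Fin m) 0ℓ
  AtLeast t x y = t ≤ℤ w E x y

  ≤minWeight⇒Linked : ∀ {t} x vs y → t ≤ℤ minWeight E x vs y → Linked (AtLeast t) (x ∷ vs ++ [ y ])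
  ≤minWeight⇒Linked x []       y t≤ = t≤ ∷ [-]
  ≤minWeight⇒Linked x (v ∷ vs) y t≤ =
    ≤ℤ-trans t≤ (i⊓j≤i _ _) ∷ ≤minWeight⇒Linked v vs y (≤ℤ-trans t≤ (i⊓j≤j _ _))

  Linked⇒≤minWeight : ∀ {t} x vs y → Linked (AtLeast t) (x ∷ vs ++ [ y ]) → t ≤ℤ minWeight E x vs y
  Linked⇒≤minWeight x []       y (r ∷ [-]) = r
  Linked⇒≤minWeight x (v ∷ vs) y (r ∷ lnk) = ⊓-glb r (Linked⇒≤minWeight v vs y lnk)

  ∈-allLists : ∀ k {vs} → length vs ≤ k → vs ∈ˡ allLists E k
  ∈-allLists zero    {[]}     _            = here refl
  ∈-allLists (suc k) {[]}     _            = here refl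
  ∈-allLists (suc k) {v ∷ vs} (s≤s |vs|≤k) =
    there (∈-concatMap⁺ _ (Any.map (λ { refl → ∈-map⁺ (v ∷_) (∈-allLists k |vs|≤k) }) (∈-allFin v)))

  ∈-pathIntermediates : ∀ {x y vs} → Unique (x ∷ vs ++ [ y ]) → vs ∈ˡ pathIntermediates E x y
  ∈-pathIntermediates {vs = vs} uniq = ∈-filter⁺ _ (∈-allLists m |vs|≤m) uniq
    where
    |vs|≤m : length vs ≤ m
    |vs|≤m = ≤-trans (≤-trans (length-++-≤ˡ vs) (n≤1+n _)) (length-Unique≤ uniq)

  minWeight≤B : ∀ {x y vs} → vs ∈ˡ pathIntermediates E x y → minWeight E x vs y ≤ℤ B E x y
  minWeight≤B {x} {y} vs∈ = ∈⇒≤foldr-⊔ _ (∈-map⁺ (λ vs → minWeight E x vs y) vs∈)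

  B-attained : ∀ x y → ∃ λ vs → B E x y ≡ minWeight E x vs y
  B-attained x y = let vs , _ , eq = ∈-map⁻ _ {xs = [] ∷ pathIntermediates E x y} B∈ in vs , eq
    where
    B∈ : B E x y ∈ˡ map (λ vs → minWeight E x vs y) ([] ∷ pathIntermediates E x y)
    B∈ = foldr-⊔-∈ (w E x y) _

  B-triangle : ∀ {t x y z} → x ≢ z → t ≤ℤ B E x y → t ≤ℤ B E y z → t ≤ℤ B E x z
  B-triangle {t} {x} {y} {z} x≢z t≤xy t≤yz
    with vs₁ , eq₁ ← B-attained x y | vs₂ , eq₂ ← B-attained y z
    with SimplePaths.shortcut _≟_ (AtLeast t) (vs₁ ++ y ∷ vs₂)
           (Linked-join vs₁ (≤minWeight⇒Linked x vs₁ y (subst (t ≤ℤ_) eq₁ t≤xy))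
                            (≤minWeight⇒Linked y vs₂ z (subst (t ≤ℤ_) eq₂ t≤yz)))
  ... | inj₁ x≡z               = contradiction x≡z x≢z
  ... | inj₂ (vs , uniq , lnk) =
    ≤ℤ-trans (Linked⇒≤minWeight x vs z lnk) (minWeight≤B (∈-pathIntermediates uniq))

module SchulzeOrder {m n} (E : Election m n) where
  open Beatpath E using (B-triangle)

  _≺ˢ_ : Rel (Fin m) 0ℓ
  x ≺ˢ y = T (_<ˢ_ E x y)

  ≺ˢ⇔ : ∀ {x y} → x ≺ˢ y ⇔ (x ≢ y × B E x y <ℤ B E y x)
  ≺ˢ⇔ {x} {y} with x ≟ y | B E x y <? B E y x
  ... | yes x≡y | _      = mk⇔ (λ ()) (λ (x≢y , _) → x≢y x≡y)
  ... | no  _   | no  ≮  = mk⇔ (λ ()) (λ (_ , <) → ≮ <)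
  ... | no  x≢y | yes <  = mk⇔ (λ _ → x≢y , <) _

  ≺ˢ-irrefl : Irreflexive _≡_ _≺ˢ_
  ≺ˢ-irrefl refl x≺x = proj₁ (Equivalence.to ≺ˢ⇔ x≺x) refl

  ≺ˢ-trans : Transitive _≺ˢ_
  ≺ˢ-trans {x} {y} {z} x≺y y≺z
    with x≢y , xy<yx ← Equivalence.to ≺ˢ⇔ x≺y | y≢z , yz<zy ← Equivalence.to ≺ˢ⇔ y≺z =
    Equivalence.from ≺ˢ⇔ (x≢z , ≰⇒> zx≰xz)
    where
    x≢z : x ≢ z
    x≢z refl = <-asym xy<yx yz<zy

    -- The smaller of B(y,x) and B(z,y) bounds the whole cycle x → z → y → x,
    -- contradicting x ≺ˢ y or y ≺ˢ z respectively.
    zx≰xz : ¬ (B E z x ≤ℤ B E x z)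
    zx≰xz zx≤xz with ≤-total (B E y x) (B E z y)
    ... | inj₁ yx≤zy = <⇒≱ xy<yx (B-triangle x≢y (≤ℤ-trans (B-triangle (≢-sym x≢z) yx≤zy ≤ℤ-refl) zx≤xz) yx≤zy)
    ... | inj₂ zy≤yx = <⇒≱ yz<zy (B-triangle y≢z zy≤yx (≤ℤ-trans (B-triangle (≢-sym x≢z) ≤ℤ-refl zy≤yx) zx≤xz))

  ≺ˢ-isStrictPartialOrder : IsStrictPartialOrder _≡_ _≺ˢ_
  ≺ˢ-isStrictPartialOrder = record
    { isEquivalence = isEquivalence
    ; irrefl        = ≺ˢ-irrefl
    ; trans         = ≺ˢ-trans
    ; <-resp-≈      = resp₂ _≺ˢ_
    }

module _ {m : ℕ} where

  select : Subset m → (Fin m → Bool) → Subset m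
  select S f = tabulate (λ x → lookupᵛ S x ∧ f x)

  ∈⇒T-lookup : ∀ {S : Subset m} {x} → x ∈ S → T (lookupᵛ S x)
  ∈⇒T-lookup x∈S = subst T (sym ([]=⇒lookup x∈S)) _

  T-lookup⇒∈ : ∀ {S : Subset m} {x} → T (lookupᵛ S x) → x ∈ S
  T-lookup⇒∈ {S} {x} t = lookup⇒[]= x S (Equivalence.to T-≡ t)

  ∈-select⁺ : ∀ {S f x} → x ∈ S → T (f x) → x ∈ select S f
  ∈-select⁺ {S} {f} {x} x∈S fx =
    T-lookup⇒∈ (subst T (sym (lookup∘tabulate _ x)) (Equivalence.from T-∧ (∈⇒T-lookup x∈S , fx)))

  ∈-select⁻ : ∀ {S f x} → x ∈ select S f → x ∈ S × T (f x)
  ∈-select⁻ {S} {f} {x} x∈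
    with Sx , fx ← Equivalence.to T-∧ (subst T (lookup∘tabulate _ x) (∈⇒T-lookup x∈)) = T-lookup⇒∈ Sx , fx

  ∣p∣>0⇒Nonempty : ∀ {p : Subset m} → 0 < ∣ p ∣ → Nonempty p
  ∣p∣>0⇒Nonempty {p} 0<∣p∣ with nonempty? p
  ... | yes ne  = ne
  ... | no  ¬ne = contradiction (trans (cong ∣_∣ (Empty-unique ¬ne)) (∣⊥∣≡0 m)) (≢-sym (<⇒≢ 0<∣p∣))

suc∣p-x∣≡∣p∣ : ∀ {m} {p : Subset m} {x} → x ∈ p → suc ∣ p - x ∣ ≡ ∣ p ∣
suc∣p-x∣≡∣p∣ {p = inside  ∷ p} here        = cong (suc ∘ ∣_∣) (p─⊥≡p p)
suc∣p-x∣≡∣p∣ {p = inside  ∷ p} (there x∈p) = cong suc (suc∣p-x∣≡∣p∣ x∈p)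
suc∣p-x∣≡∣p∣ {p = outside ∷ p} (there x∈p) = suc∣p-x∣≡∣p∣ x∈p

module FewAbove {m} {_≺_ : Fin m → Fin m → Bool}
                (isSPO : IsStrictPartialOrder _≡_ (λ x y → T (x ≺ y))) where
  open IsStrictPartialOrder isSPO using (irrefl)

  above : Subset m → Fin m → Subset m
  above S p = select S (p ≺_)

  fewAbove : Subset m → ℕ → Subset m
  fewAbove S k = select S (λ p → ∣ above S p ∣ <ᵇ k)

  ∈-above⁺ : ∀ {S p x} → x ∈ S → T (p ≺ x) → x ∈ above S p
  ∈-above⁺ {p = p} = ∈-select⁺ {f = p ≺_}

  ∈-above⁻ : ∀ {S p x} → x ∈ above S p → x ∈ S × T (p ≺ x)
  ∈-above⁻ {S} {p} = ∈-select⁻ {S = S} {f = p ≺_}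

  ∈-fewAbove⁺ : ∀ {S k p} → p ∈ S → ∣ above S p ∣ < k → p ∈ fewAbove S k
  ∈-fewAbove⁺ {S} {k} p∈S few = ∈-select⁺ {f = λ p → ∣ above S p ∣ <ᵇ k} p∈S (<⇒<ᵇ few)

  ∈-fewAbove⁻ : ∀ {S k p} → p ∈ fewAbove S k → p ∈ S × ∣ above S p ∣ < k
  ∈-fewAbove⁻ {S} {k} p∈
    with p∈S , few ← ∈-select⁻ {S = S} {f = λ p → ∣ above S p ∣ <ᵇ k} p∈ = p∈S , <ᵇ⇒< _ k few

  Minimal : Subset m → Fin m → Set
  Minimal S q = q ∈ S × ∀ {p} → p ∈ S → ¬ T (p ≺ q)

  ∃-minimal : ∀ {S} → Nonempty S → ∃ (Minimal S)
  ∃-minimal {S} (x , x∈S) = descend (spo-wellFounded isSPO x) x∈S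
    where
    descend : ∀ {x} → Acc (λ x y → T (x ≺ y)) x → x ∈ S → ∃ (Minimal S)
    descend {x} (acc rs) x∈S with any? (λ y → y ∈ˢ? S ×-dec T? (y ≺ x))
    ... | yes (y , y∈S , y≺x) = descend (rs y≺x) y∈S
    ... | no  ∄y              = x , x∈S , λ p∈S p≺x → ∄y (_ , p∈S , p≺x)

  ∣above∣<∣S∣ : ∀ {S p} → p ∈ S → ∣ above S p ∣ < ∣ S ∣
  ∣above∣<∣S∣ {S} {p} p∈S = ≤-<-trans (p⊆q⇒∣p∣≤∣q∣ above⊆S-p) (x∈p⇒∣p-x∣<∣p∣ p∈S)
    where
    above⊆S-p : above S p ⊆ S - p
    above⊆S-p x∈ with x∈S , p≺x ← ∈-above⁻ {S} {p} x∈ = x∈p∧x≢y⇒x∈p-y x∈S (λ { refl → irrefl refl p≺x })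

  above-remove-minimal : ∀ {S p q} → Minimal S q → p ∈ S → above S p ⊆ above (S - q) p
  above-remove-minimal {S} {p} {q} (_ , q-min) p∈S x∈ with x∈S , p≺x ← ∈-above⁻ {S} {p} x∈ =
    ∈-above⁺ {S - q} {p} (x∈p∧x≢y⇒x∈p-y x∈S (λ { refl → q-min p∈S p≺x })) p≺x

  fewAbove-remove-minimal : ∀ {S q k} → Minimal S q → fewAbove (S - q) k ⊆ fewAbove S k
  fewAbove-remove-minimal {S} {q} {k} q-min {p} p∈ with p∈S-q , few ← ∈-fewAbove⁻ {S - q} {k} p∈ =
    ∈-fewAbove⁺ {S} {k} p∈S (≤-<-trans (p⊆q⇒∣p∣≤∣q∣ (above-remove-minimal q-min p∈S)) few)
    where
    p∈S : p ∈ S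
    p∈S = p─q⊆p S _ p∈S-q

  k≤∣fewAbove∣ : ∀ {S k} → k ≤ ∣ S ∣ → k ≤ ∣ fewAbove S k ∣
  k≤∣fewAbove∣ {S} {k} k≤∣S∣ = go (∣ S ∣ ∸ k) S (sym (m∸n+n≡m k≤∣S∣))
    where
    go : ∀ d S → ∣ S ∣ ≡ d + k → k ≤ ∣ fewAbove S k ∣
    go zero    S ∣S∣≡k = ≤-trans (≤-reflexive (sym ∣S∣≡k)) (p⊆q⇒∣p∣≤∣q∣ S⊆fewAbove)
      where
      S⊆fewAbove : S ⊆ fewAbove S k
      S⊆fewAbove p∈S = ∈-fewAbove⁺ {S} {k} p∈S (subst (_ <_) ∣S∣≡k (∣above∣<∣S∣ p∈S))
    go (suc d) S ∣S∣≡1+d+k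
      with q , q∈S , q-min ← ∃-minimal (∣p∣>0⇒Nonempty (subst (0 <_) (sym ∣S∣≡1+d+k) z<s)) =
      ≤-trans (go d (S - q) ∣S-q∣≡d+k) (p⊆q⇒∣p∣≤∣q∣ (fewAbove-remove-minimal {S} {q} {k} (q∈S , q-min)))
      where
      ∣S-q∣≡d+k : ∣ S - q ∣ ≡ d + k
      ∣S-q∣≡d+k = suc-injective (trans (suc∣p-x∣≡∣p∣ q∈S) ∣S∣≡1+d+k)

∣step∣≤ : ∀ {m n} (E : Election m n) S p {i} → 1 ≤ i → ∣ higher E S p ∣ ≤ i → ∣ step E S p ∣ ≤ i
∣step∣≤ E S p 1≤i ∣higher∣≤i with ∣ higher E S p ∣ ≡ᵇ 0
... | true  = ≤-trans (≤-reflexive (∣⁅x⁆∣≡1 p)) 1≤i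
... | false = ∣higher∣≤i

mainTheorem7 : ∀ {m n : ℕ} (E : Election m n) (S : Subset m) → Reachable E S → 1 < ∣ S ∣ → (i : ℕ) → 1 ≤ i → i < ∣ S ∣ → i + 1 ≤ ∣ goodPivots E S i ∣
mainTheorem7 E S _ _ i 1≤i i<∣S∣ = begin
  i + 1                  ≡⟨ +-comm i 1 ⟩
  suc i                  ≤⟨ k≤∣fewAbove∣ {S} i<∣S∣ ⟩
  ∣ fewAbove S (suc i) ∣ ≤⟨ p⊆q⇒∣p∣≤∣q∣ fewAbove⊆goodPivots ⟩
  ∣ goodPivots E S i ∣   ∎
  where
  open ≤-Reasoning
  open SchulzeOrder E using (≺ˢ-isStrictPartialOrder)
  open FewAbove ≺ˢ-isStrictPartialOrder using (fewAbove; k≤∣fewAbove∣; ∈-fewAbove⁻)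

  fewAbove⊆goodPivots : fewAbove S (suc i) ⊆ goodPivots E S i
  fewAbove⊆goodPivots p∈ with p∈S , few ← ∈-fewAbove⁻ {S} {suc i} p∈ =
    ∈-select⁺ {f = λ p → ∣ step E S p ∣ ≤ᵇ i} p∈S (≤⇒≤ᵇ (∣step∣≤ E S _ 1≤i (≤-pred few)))
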